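{- For all integers $s,n\ge 3$, we have $r(L_{K_s}, K_n^{(3)}) < (2n)^{sn}$.
   Context: A $3$-graph is a $3$-uniform hypergraph. For $3$-graphs $H_1,H_2$, $r(H_1,H_2)$ is the smallest $N$ such that every $3$-graph on $N$ vertices contains a copy of $H_1$ or its complement contains a copy of $H_2$. $K_n^{(3)}$ is the complete $3$-graph on $n$ vertices and $K_s$ the complete graph on $s$ vertices. For a graph $G$, its link hypergraph $L_G$ is the $3$-graph on $V(G)\cup\{u\}$ ($u$ a new vertex) whose edges are the triples $\{u,v,w\}$ with $\{v,w\}\in E(G)$. -}

module Defs where

open import Data.Nat using (ℕ; suc; _<_)
open import Data.Fin using (Fin; zero; suc)
open import Data.Bool using (Bool; true; false; not; _∨_)
open import Data.Product using (Σ; _×_)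
open import Data.Sum using (_⊎_)
open import Relation.Binary.PropositionalEquality using (_≡_; _≢_)
open import Function.Definitions using (Injective)

-- The edge indicator is only
-- meaningful on triples of pairwise distinct vertices; it is required to be
-- invariant under permuting the triple (so it describes a set of 3-subsets).
record Graph3 (k : ℕ) : Set where
  field
    edge  : Fin k → Fin k → Fin k → Bool
    sym₁₂ : ∀ x y z → edge x y z ≡ edge y x z
    sym₂₃ : ∀ x y z → edge x y z ≡ edge x z y
open Graph3 public

Distinct3 : ∀ {k} → Fin k → Fin k → Fin k → Set
Distinct3 x y z = x ≢ y × y ≢ z × x ≢ z

complement : ∀ {N} → Graph3 N → Graph3 N
complement H = record
  { edge  = λ x y z → not (edge H x y z)
  ; sym₁₂ = λ x y z → cong′ (sym₁₂ H x y z)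
  ; sym₂₃ = λ x y z → cong′ (sym₂₃ H x y z) }
  where
  cong′ : ∀ {a b : Bool} → a ≡ b → not a ≡ not b
  cong′ Relation.Binary.PropositionalEquality.refl = Relation.Binary.PropositionalEquality.refl

-- H contains a copy of F: an injective vertex map sending edges of F to edges of H
-- (not necessarily induced).
Contains : ∀ {N k} → Graph3 N → Graph3 k → Set
Contains {N} {k} H F =
  Σ (Fin k → Fin N) λ f → Injective _≡_ _≡_ f ×
    (∀ x y z → Distinct3 x y z → edge F x y z ≡ true →
       edge H (f x) (f y) (f z) ≡ true)

K3 : (n : ℕ) → Graph3 n
K3 n = record
  { edge  = λ _ _ _ → true
  ; sym₁₂ = λ _ _ _ → Relation.Binary.PropositionalEquality.refl
  ; sym₂₃ = λ _ _ _ → Relation.Binary.PropositionalEquality.refl }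

isZero : ∀ {k} → Fin k → Bool
isZero zero    = true
isZero (suc _) = false

-- link hypergraph L_{K_s} of the complete graph K_s, on vertices Fin (suc s):
-- vertex zero is the new vertex u, vertices suc i are the vertices of K_s.
-- A triple of distinct vertices is an edge iff it contains u (then the other
-- two are distinct vertices of K_s, i.e. an edge of K_s).
LinkK : (s : ℕ) → Graph3 (suc s)
LinkK s = record
  { edge  = λ x y z → isZero x ∨ isZero y ∨ isZero z
  ; sym₁₂ = λ x y z → lem₁ (isZero x) (isZero y) (isZero z)
  ; sym₂₃ = λ x y z → lem₂ (isZero x) (isZero y) (isZero z) }
  where
  open Relation.Binary.PropositionalEquality using (refl)
  lem₁ : ∀ a b c → (a ∨ b ∨ c) ≡ (b ∨ a ∨ c)
  lem₁ true  true  c = refl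
  lem₁ true  false c = refl
  lem₁ false true  c = refl
  lem₁ false false c = refl
  lem₂ : ∀ a b c → (a ∨ b ∨ c) ≡ (a ∨ c ∨ b)
  lem₂ true  b c = refl
  lem₂ false true  true  = refl
  lem₂ false true  false = refl
  lem₂ false false true  = refl
  lem₂ false false false = refl

Arrows : ∀ {k l} → ℕ → Graph3 k → Graph3 l → Set
Arrows N F₁ F₂ = (H : Graph3 N) → Contains H F₁ ⊎ Contains (complement H) F₂

-- r(F₁,F₂) < M.  Since r(F₁,F₂) is the least N with Arrows N F₁ F₂, this holds
-- iff some N < M satisfies Arrows N F₁ F₂.
RamseyLT : ∀ {k l} → Graph3 k → Graph3 l → ℕ → Set
RamseyLT F₁ F₂ M = Σ ℕ λ N → N < M × Arrows N F₁ F₂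

-- Maintain a pool S of unused vertices, vertices
-- b₁,…,b_k such that every triple among them, and every bᵢ bⱼ x with x ∈ S, is a
-- non-edge, and for each bᵢ a star of leaves f with every bᵢ f f′ and every
-- bᵢ f x (x ∈ S) an edge.  Take v ∈ S, where |S| ≥ n^(P+1).  If some i has at
-- least n^P vertices x ∈ S with bᵢ v x an edge, v becomes a leaf of bᵢ and S
-- shrinks to those x.  Otherwise each of the k < n vertices bᵢ excludes fewer
-- than n^P vertices, so at least n^P remain with no bᵢ v x an edge; v becomes
-- b_{k+1} and S shrinks to them.  A star with s leaves is a copy of L_{K_s},
-- and n vertices bᵢ a copy of K_n^(3) in the complement; before either, fewer
-- than n·s vertices have been placed, so n^(sn) vertices never exhaust S.
module Submission where

open import Defs
open import Data.Nat
  using ( ℕ; zero; suc; pred; _+_; _*_; _^_; _≤_; _<_; z≤n; s≤s; z<s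
        ; NonZero; >-nonZero; >-nonZero⁻¹; _<?_; _≟_)
open import Data.Nat.Properties
open import Algebra.Properties.Monoid.Sum +-0-monoid using (sum; sum-cong-≗)
open import Data.Bool using (true; false; not)
import Data.Bool as Bool
open import Data.Bool.Properties using (¬-not)
open import Data.Fin using (Fin; zero; suc)
import Data.Fin.Properties as Fin
open import Data.Vec.Functional using (Vector; updateAt) renaming (_∷_ to _◂_)
open import Data.Vec.Functional.Properties using (updateAt-updates; updateAt-minimal)
open import Data.List using (List; []; _∷_; length; filter; allFin)
open import Data.List.Properties using (length-tabulate)
open import Data.List.Membership.Propositional using (_∈_; _∉_)
open import Data.List.Membership.Propositional.Properties using (∈-filter⁻)
open import Data.List.Relation.Binary.Subset.Propositional using (_⊆_)
open import Data.List.Relation.Binary.Subset.Propositional.Properties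
  using (⊆-trans; filter-⊆)
open import Data.List.Relation.Unary.Any using (here; there)
open import Data.List.Relation.Unary.AllPairs using (_∷_)
open import Data.List.Relation.Unary.Unique.Propositional using (Unique)
open import Data.List.Relation.Unary.Unique.Propositional.Properties
  using (filter⁺; allFin⁺; Unique[x∷xs]⇒x∉xs)
open import Data.Product using (_,_; proj₂)
open import Data.Sum using (_⊎_; inj₁; inj₂)
open import Function using (_∘_; id)
open import Function.Definitions using (Injective)
open import Relation.Nullary using (¬_; yes; no; contradiction)
open import Level using (0ℓ)
open import Relation.Unary using (Pred; Decidable)
open import Relation.Unary.Properties using (∁?)
open import Relation.Binary.PropositionalEquality
open ≤-Reasoning

length-filter-∁ : ∀ {A : Set} {P : Pred A 0ℓ} (P? : Decidable P) xs →
  length (filter P? xs) + length (filter (∁? P?) xs) ≡ length xs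
length-filter-∁ P? [] = refl
length-filter-∁ P? (x ∷ xs) with P? x
... | yes _ = cong suc (length-filter-∁ P? xs)
... | no _  = trans (+-suc _ _) (cong suc (length-filter-∁ P? xs))

data HeavyOrAvoiding {A : Set} {k} (P : Fin k → Pred A 0ℓ) (m : ℕ) (U : List A) : Set where
  heavy    : ∀ i V → V ⊆ U → Unique V → (∀ {x} → x ∈ V → P i x) → m < length V →
             HeavyOrAvoiding P m U
  avoiding : ∀ Z → Z ⊆ U → Unique Z → (∀ {x} → x ∈ Z → ∀ i → ¬ P i x) →
             length U ≤ k * m + length Z → HeavyOrAvoiding P m U

heavy-or-avoiding : ∀ {A : Set} {k} {P : Fin k → Pred A 0ℓ} → (∀ i → Decidable (P i)) →
  ∀ m {U} → Unique U → HeavyOrAvoiding P m U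
heavy-or-avoiding {k = zero} P? m {U} U! = avoiding U (λ x∈U → x∈U) U! (λ _ ()) ≤-refl
heavy-or-avoiding {k = suc k} {P} P? m {U} U! with m <? length (filter (P? zero) U)
... | yes many =
  heavy zero _ (filter-⊆ (P? zero) U) (filter⁺ (P? zero) U!) (proj₂ ∘ ∈-filter⁻ (P? zero) {xs = U}) many
... | no few with heavy-or-avoiding (P? ∘ suc) m (filter⁺ (∁? (P? zero)) U!)
...   | heavy i V V⊆ V! PV many = heavy (suc i) V (⊆-trans V⊆ (filter-⊆ _ U)) V! PV many
...   | avoiding Z Z⊆ Z! ¬PZ bound =
  avoiding Z (⊆-trans Z⊆ (filter-⊆ _ U)) Z! ¬P bound′
  where
  ¬P : ∀ {x} → x ∈ Z → ∀ i → ¬ P i x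
  ¬P x∈Z zero    = proj₂ (∈-filter⁻ (∁? (P? zero)) {xs = U} (Z⊆ x∈Z))
  ¬P x∈Z (suc i) = ¬PZ x∈Z i
  bound′ : length U ≤ suc k * m + length Z
  bound′ = begin
    length U                                                     ≡⟨ sym (length-filter-∁ (P? zero) U) ⟩
    length (filter (P? zero) U) + length (filter (∁? (P? zero)) U) ≤⟨ +-mono-≤ (≮⇒≥ few) bound ⟩
    m + (k * m + length Z)                                       ≡⟨ sym (+-assoc m _ _) ⟩
    suc k * m + length Z                                         ∎

avoiders-survive : ∀ {n k m t z} → 1 < n → k < n → n * suc m ≤ suc t → t ≤ k * m + z →
  suc m ≤ z
avoiders-survive {n} {k} {m} {t} {z} 1<n k<n n[m+1]≤1+t t≤ =
  +-cancelˡ-≤ (k * m) (suc m) z (≤-pred (begin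
    suc (k * m + suc m)   ≡⟨ cong suc (+-comm (k * m) (suc m)) ⟩
    2 + suc k * m         ≤⟨ +-mono-≤ 1<n (*-monoˡ-≤ m k<n) ⟩
    n + n * m             ≡⟨ sym (*-suc n m) ⟩
    n * suc m             ≤⟨ n[m+1]≤1+t ⟩
    suc t                 ≤⟨ s≤s t≤ ⟩
    suc (k * m + z)       ∎))

sum-≤-* : ∀ {k c} (g : Vector ℕ k) → (∀ i → g i ≤ c) → sum g ≤ k * c
sum-≤-* {zero}  g g≤ = z≤n
sum-≤-* {suc k} g g≤ = +-mono-≤ (g≤ zero) (sum-≤-* (g ∘ suc) (g≤ ∘ suc))

sum-suc-at : ∀ {k} (g g′ : Vector ℕ k) i → g′ i ≡ suc (g i) → (∀ j → j ≢ i → g′ j ≡ g j) →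
  sum g′ ≡ suc (sum g)
sum-suc-at g g′ zero    g′i others = cong₂ _+_ g′i (sum-cong-≗ (λ j → others (suc j) λ ()))
sum-suc-at g g′ (suc i) g′i others = trans
  (cong₂ _+_ (others zero λ ()) (sum-suc-at (g ∘ suc) (g′ ∘ suc) i g′i
    (λ j j≢i → others (suc j) (j≢i ∘ Fin.suc-injective))))
  (+-suc (g zero) _)

updateAt-∀ : ∀ {A : Set} {k} {Q : Fin k → A → Set} {xs : Vector A k} i {f : A → A} →
  (∀ j → Q j (xs j)) → Q i (f (xs i)) → ∀ j → Q j (updateAt xs i f j)
updateAt-∀ {Q = Q} {xs} i all-Q Q-new j with j Fin.≟ i
... | yes refl = subst (Q i) (sym (updateAt-updates i xs)) Q-new
... | no j≢i   = subst (Q j) (sym (updateAt-minimal j i xs j≢i)) (all-Q j)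

◂-injective : ∀ {A : Set} {k} {v : A} {f : Fin k → A} →
  Injective _≡_ _≡_ f → (∀ i → v ≢ f i) → Injective _≡_ _≡_ (v ◂ f)
◂-injective f-inj v∉f {zero}  {zero}  _  = refl
◂-injective f-inj v∉f {zero}  {suc j} eq = contradiction eq (v∉f j)
◂-injective f-inj v∉f {suc i} {zero}  eq = contradiction (sym eq) (v∉f i)
◂-injective f-inj v∉f {suc i} {suc j} eq = cong suc (f-inj eq)

module Colouring {N} (H : Graph3 N) where

  Red Blue : Fin N → Fin N → Fin N → Set
  Red  x y z = edge H x y z ≡ true
  Blue x y z = edge H x y z ≡ false

  edge-rotate : ∀ x y z → edge H x y z ≡ edge H y z x
  edge-rotate x y z = trans (sym₁₂ H x y z) (sym₂₃ H y x z)

  record Star (u : Fin N) {c} (f : Fin c → Fin N) : Set where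
    field
      leaves-injective : Injective _≡_ _≡_ f
      centre∉leaves    : ∀ j → u ≢ f j
      red-pairs        : ∀ j j′ → j ≢ j′ → Red u (f j) (f j′)

  BlueClique : ∀ {k} → (Fin k → Fin N) → Set
  BlueClique b = ∀ i j l → Distinct3 i j l → Blue (b i) (b j) (b l)

  star⇒link : ∀ {u c} {f : Fin c → Fin N} → Star u f → Contains H (LinkK c)
  star⇒link {u} {c} {f} star = u ◂ f , ◂-injective leaves-injective centre∉leaves , red
    where
    open Star star
    red : ∀ x y z → Distinct3 x y z → edge (LinkK c) x y z ≡ true →
      Red ((u ◂ f) x) ((u ◂ f) y) ((u ◂ f) z)
    red zero    zero    _       (x≢y , _)     _ = contradiction refl x≢y
    red zero    (suc _) zero    (_ , _ , x≢z) _ = contradiction refl x≢z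
    red (suc _) zero    zero    (_ , y≢z , _) _ = contradiction refl y≢z
    red zero    (suc y) (suc z) (_ , y≢z , _) _ = red-pairs y z (y≢z ∘ cong suc)
    red (suc x) zero    (suc z) (_ , _ , x≢z) _ =
      trans (sym₁₂ H (f x) u (f z)) (red-pairs x z (x≢z ∘ cong suc))
    red (suc x) (suc y) zero    (x≢y , _)     _ =
      trans (sym (edge-rotate u (f x) (f y))) (red-pairs x y (x≢y ∘ cong suc))

  blueClique⇒co-K3 : ∀ {k} {b : Fin k → Fin N} → Injective _≡_ _≡_ b → BlueClique b →
    Contains (complement H) (K3 k)
  blueClique⇒co-K3 {b = b} b-inj blue = b , b-inj , λ i j l ijl _ → cong not (blue i j l ijl)

  star-◂ : ∀ {u v c} {f : Fin c → Fin N} → Star u f → u ≢ v → (∀ j → v ≢ f j) →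
    (∀ j → Red u (f j) v) → Star u (v ◂ f)
  star-◂ {u} {v} {f = f} star u≢v v∉f red-v = record
    { leaves-injective = ◂-injective leaves-injective v∉f
    ; centre∉leaves    = λ { zero → u≢v ; (suc j) → centre∉leaves j }
    ; red-pairs        = red }
    where
    open Star star
    red : ∀ j j′ → j ≢ j′ → Red u ((v ◂ f) j) ((v ◂ f) j′)
    red zero     zero     j≢j′ = contradiction refl j≢j′
    red zero     (suc j′) _    = trans (sym₂₃ H u v (f j′)) (red-v j′)
    red (suc j)  zero     _    = red-v j
    red (suc j)  (suc j′) j≢j′ = red-pairs j j′ (j≢j′ ∘ cong suc)

  blueClique-◂ : ∀ {k v} {b : Fin k → Fin N} → BlueClique b →
    (∀ i j → i ≢ j → Blue (b i) (b j) v) → BlueClique (v ◂ b)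
  blueClique-◂ {v = v} {b} blue blue-v = clique
    where
    clique : BlueClique (v ◂ b)
    clique zero    zero    _       (i≢j , _)           = contradiction refl i≢j
    clique zero    (suc _) zero    (_ , _ , i≢l)       = contradiction refl i≢l
    clique (suc _) zero    zero    (_ , j≢l , _)       = contradiction refl j≢l
    clique zero    (suc j) (suc l) (_ , j≢l , _)       =
      trans (edge-rotate v (b j) (b l)) (blue-v j l (j≢l ∘ cong suc))
    clique (suc i) zero    (suc l) (_ , _ , i≢l)       =
      trans (sym₂₃ H (b i) v (b l)) (blue-v i l (i≢l ∘ cong suc))
    clique (suc i) (suc j) zero    (i≢j , _)           = blue-v i j (i≢j ∘ cong suc)
    clique (suc i) (suc j) (suc l) (i≢j , j≢l , i≢l)   =
      blue i j l (i≢j ∘ cong suc , j≢l ∘ cong suc , i≢l ∘ cong suc)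

record Fan (N : ℕ) : Set where
  constructor fan
  field
    size : ℕ
    leaf : Fin size → Fin N
open Fan

grow : ∀ {N} → Fin N → Fan N → Fan N
grow v φ = fan (suc (size φ)) (v ◂ leaf φ)

-- The vertices taken out of the pool so far: each bᵢ together with its leaves.
placed : ∀ {N k} → Vector (Fan N) k → ℕ
placed F = sum (λ i → suc (size (F i)))

placed-grow : ∀ {N k} (F : Vector (Fan N) k) i v → placed (updateAt F i (grow v)) ≡ suc (placed F)
placed-grow F i v = sum-suc-at _ _ i (cong (suc ∘ size) (updateAt-updates i F))
  (λ j j≢i → cong (suc ∘ size) (updateAt-minimal j i F j≢i))

module Greedy {N} (H : Graph3 N) (s n : ℕ) .{{_ : NonZero s}} (1<n : 1 < n) where
  open Colouring H

  instance
    n≢0 : NonZero n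
    n≢0 = >-nonZero (<-trans z<s 1<n)

  record GoodFan (u : Fin N) (S : List (Fin N)) (φ : Fan N) : Set where
    field
      star       : Star u (leaf φ)
      red-to-S   : ∀ j {x} → x ∈ S → Red u (leaf φ j) x
      leaves∉S   : ∀ j → leaf φ j ∉ S
      incomplete : size φ < s
  open GoodFan

  goodFan-⊆ : ∀ {u S V φ} → V ⊆ S → GoodFan u S φ → GoodFan u V φ
  goodFan-⊆ V⊆S good = record
    { star       = star good
    ; red-to-S   = λ j → red-to-S good j ∘ V⊆S
    ; leaves∉S   = λ j → leaves∉S good j ∘ V⊆S
    ; incomplete = incomplete good }

  star-grow : ∀ {u v T φ} → GoodFan u (v ∷ T) φ → u ≢ v → Star u (leaf (grow v φ))
  star-grow good u≢v = star-◂ (star good) u≢v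
    (λ j v≡f → leaves∉S good j (here (sym v≡f))) (λ j → red-to-S good j (here refl))

  goodFan-grow : ∀ {u v T V φ} → GoodFan u (v ∷ T) φ → u ≢ v → v ∉ T → V ⊆ T →
    (∀ {x} → x ∈ V → Red u v x) → suc (size φ) < s → GoodFan u V (grow v φ)
  goodFan-grow {v = v} {φ = φ} good u≢v v∉T V⊆T red-v room = record
    { star       = star-grow good u≢v
    ; red-to-S   = red
    ; leaves∉S   = λ { zero → v∉T ∘ V⊆T ; (suc j) → leaves∉S good j ∘ there ∘ V⊆T }
    ; incomplete = room }
    where
    red : ∀ j {x} → x ∈ _ → Red _ ((v ◂ leaf φ) j) x
    red zero    = red-v
    red (suc j) = red-to-S good j ∘ there ∘ V⊆T

  empty-goodFan : ∀ {u S} → GoodFan u S (fan 0 λ ())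
  empty-goodFan = record
    { star       = record { leaves-injective = λ { {()} } ; centre∉leaves = λ () ; red-pairs = λ () }
    ; red-to-S   = λ ()
    ; leaves∉S   = λ ()
    ; incomplete = >-nonZero⁻¹ s }

  record Stage {k} (b : Fin k → Fin N) (F : Vector (Fan N) k) (S : List (Fin N)) : Set where
    field
      S-unique       : Unique S
      blue-injective : Injective _≡_ _≡_ b
      blue-clique    : BlueClique b
      blue-to-S      : ∀ i j → i ≢ j → ∀ {x} → x ∈ S → Blue (b i) (b j) x
      blue∉S         : ∀ i → b i ∉ S
      fans           : ∀ i → GoodFan (b i) S (F i)
  open Stage

  stage-⊆ : ∀ {k b F S V} → Stage {k} b F S → V ⊆ S → Unique V → Stage b F V
  stage-⊆ st V⊆S V! = record
    { S-unique       = V!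
    ; blue-injective = blue-injective st
    ; blue-clique    = blue-clique st
    ; blue-to-S      = λ i j i≢j → blue-to-S st i j i≢j ∘ V⊆S
    ; blue∉S         = λ i → blue∉S st i ∘ V⊆S
    ; fans           = λ i → goodFan-⊆ V⊆S (fans st i) }

  stage-red : ∀ {k b F v T V} i → Stage {k} b F (v ∷ T) → V ⊆ T → Unique V →
    (∀ {x} → x ∈ V → Red (b i) v x) → suc (size (F i)) < s →
    Stage b (updateAt F i (grow v)) V
  stage-red {b = b} {V = V} i st V⊆T V! red-v room = record
    { S-unique       = S-unique st′
    ; blue-injective = blue-injective st′
    ; blue-clique    = blue-clique st′
    ; blue-to-S      = blue-to-S st′
    ; blue∉S         = blue∉S st′
    ; fans           = updateAt-∀ {Q = λ j → GoodFan (b j) V} i (fans st′)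
        (goodFan-grow (fans st i) (blue∉S st i ∘ here) v∉T V⊆T red-v room) }
    where
    st′ = stage-⊆ st (there ∘ V⊆T) V!
    v∉T = Unique[x∷xs]⇒x∉xs (S-unique st)

  stage-blue : ∀ {k b F v T Z} → Stage {k} b F (v ∷ T) → Z ⊆ T → Unique Z →
    (∀ {x} → x ∈ Z → ∀ i → Blue (b i) v x) → Stage (v ◂ b) (fan 0 (λ ()) ◂ F) Z
  stage-blue {b = b} {v = v} {Z = Z} st Z⊆T Z! blue-v = record
    { S-unique       = Z!
    ; blue-injective = ◂-injective (blue-injective st) (λ i v≡b → blue∉S st i (here (sym v≡b)))
    ; blue-clique    = blueClique-◂ (blue-clique st) (λ i j i≢j → blue-to-S st i j i≢j (here refl))
    ; blue-to-S      = blue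
    ; blue∉S         = λ { zero → v∉T ∘ Z⊆T ; (suc i) → blue∉S st i ∘ there ∘ Z⊆T }
    ; fans           = λ { zero → empty-goodFan ; (suc i) → goodFan-⊆ (there ∘ Z⊆T) (fans st i) } }
    where
    v∉T = Unique[x∷xs]⇒x∉xs (S-unique st)
    blue : ∀ i j → i ≢ j → ∀ {x} → x ∈ Z → Blue ((v ◂ b) i) ((v ◂ b) j) x
    blue zero    zero    i≢j     = contradiction refl i≢j
    blue zero    (suc j) _   {x} = λ x∈Z → trans (sym₁₂ H v (b j) x) (blue-v x∈Z j)
    blue (suc i) zero    _       = λ x∈Z → blue-v x∈Z i
    blue (suc i) (suc j) i≢j     = blue-to-S st i j (i≢j ∘ cong suc) ∘ there ∘ Z⊆T

  placed-< : ∀ {k b F S} → Stage {k} b F S → k < n → placed F < n * s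
  placed-< {k} {F = F} st k<n = begin-strict
    placed F ≤⟨ sum-≤-* _ (incomplete ∘ fans st) ⟩
    k * s    <⟨ *-monoˡ-< s k<n ⟩
    n * s    ∎

  Outcome : Set
  Outcome = Contains H (LinkK s) ⊎ Contains (complement H) (K3 n)

  -- P is the fuel: every step spends one unit and divides the pool by at most n.
  greedy : ∀ P {k b F S} → Stage {k} b F S → k < n → n * s ≤ placed F + P → n ^ P ≤ length S →
    Outcome
  greedy zero st k<n ns≤ _ =
    contradiction (subst (_ ≤_) (+-identityʳ _) ns≤) (<⇒≱ (placed-< st k<n))
  greedy (suc P) {S = []} st k<n ns≤ pool = contradiction pool (<⇒≱ (m^n>0 n (suc P)))
  greedy (suc P) {k} {b} {F} {v ∷ T} st k<n ns≤ pool =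
    step (heavy-or-avoiding (λ i x → edge H (b i) v x Bool.≟ true) m T!)
    where
    m = pred (n ^ P)
    m+1 : suc m ≡ n ^ P
    m+1 = suc-pred (n ^ P) {{m^n≢0 n P}}
    T! : Unique T
    T! with _ ∷ T! ← S-unique st = T!
    step : HeavyOrAvoiding (λ i x → Red (b i) v x) m T → Outcome
    step (heavy i V V⊆T V! red-v many) with suc (size (F i)) ≟ s
    ... | yes full = inj₁ (subst (Contains H ∘ LinkK) full
                            (star⇒link (star-grow (fans st i) (blue∉S st i ∘ here))))
    ... | no  not-full = greedy P (stage-red i st V⊆T V! red-v room) k<n
                           (subst (n * s ≤_) placed-step ns≤) (subst (_≤ length V) m+1 many)
      where
      room = ≤∧≢⇒< (incomplete (fans st i)) not-full
      placed-step : placed F + suc P ≡ placed (updateAt F i (grow v)) + P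
      placed-step = trans (+-suc _ P) (cong (_+ P) (sym (placed-grow F i v)))
    step (avoiding Z Z⊆T Z! ¬red bound)
      with stage-blue st Z⊆T Z! (λ x∈Z i → ¬-not (¬red x∈Z i)) | suc k ≟ n
    ... | st′ | yes full = inj₂ (subst (Contains (complement H) ∘ K3) full
                                   (blueClique⇒co-K3 (blue-injective st′) (blue-clique st′)))
    ... | st′ | no  not-full = greedy P st′ (≤∧≢⇒< k<n not-full)
                                 (subst (n * s ≤_) (+-suc _ P) ns≤) (subst (_≤ length Z) m+1 survivors)
      where
      survivors = avoiders-survive 1<n k<n
        (subst (λ M → n * M ≤ suc (length T)) (sym m+1) pool) bound

  link-or-co-clique : n ^ (s * n) ≤ N → Outcome
  link-or-co-clique N-large =
    greedy (s * n) initial (<-trans z<s 1<n) (≤-reflexive (*-comm n s))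
      (subst (n ^ (s * n) ≤_) (sym (length-tabulate id)) N-large)
    where
    initial : Stage (λ ()) (λ ()) (allFin N)
    initial = record
      { S-unique = allFin⁺ N ; blue-injective = λ { {()} } ; blue-clique = λ ()
      ; blue-to-S = λ () ; blue∉S = λ () ; fans = λ () }

theorem1p4 : (s n : ℕ) → 3 ≤ s → 3 ≤ n →
    RamseyLT (LinkK s) (K3 n) ((2 * n) ^ (s * n))
theorem1p4 s@(suc _) n@(suc _) _ 3≤n =
  n ^ (s * n) , ^-monoˡ-< (s * n) (m<m+n n z<s) ,
  λ H → Greedy.link-or-co-clique H s n (≤-trans (n≤1+n 2) 3≤n) ≤-refl
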